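{- Let $n,d,l,s$ be positive integers with $d(n-1)=ls$, and suppose that for each $i\in\{1,\dots,n\}$ there is a tactical configuration $(\{1,\dots,n\}\setminus\{i\},\mathcal{B}_i)$ with parameters $(n-1,s,l,d)$. Then for every positive integer $m$ there exist directed strongly regular graphs with parameters \[\big(mns,\ mls,\ mld,\ m(l-1)d,\ mld\big)\] and \[\big(mns,\ m(ls+s)-1,\ m(ld+s)-1,\ m(ld+s)-2,\ m(l+1)d\big).\]
   Context: A tactical configuration with parameters $(\bar v,\bar b,\bar k,\bar r)$ is a pair $(X,\mathcal{B})$ where $X$ is a set of $\bar v$ points and $\mathcal{B}$ is a collection of $\bar b$ subsets of $X$, each of size $\bar k$, such that every point lies in exactly $\bar r$ blocks. A directed strongly regular graph with parameters $(v,k,t,\lambda,\mu)$ is a loopless directed graph on $v$ vertices with adjacency matrix $A$ satisfying $AJ=JA=kJ$ and $A^2=tI+\lambda A+\mu(J-I-A)$, where $I$ is the identity and $J$ the all-ones matrix. -}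

module Defs where

open import Data.Nat using (ℕ; zero; suc; _+_; _*_; _∸_)
open import Data.Bool using (Bool; true; false; if_then_else_)
open import Data.Fin using (Fin; zero; suc)
open import Data.Fin.Subset using (Subset; _⊆_; ∣_∣; _∈_)
open import Data.Vec using (lookup; tabulate)
open import Relation.Binary.PropositionalEquality using (_≡_)
open import Relation.Nullary.Decidable using (⌊_⌋)
open import Data.Fin using (_≟_)
open import Data.Product using (Σ)

∑ : ∀ {n} → (Fin n → ℕ) → ℕ
∑ {zero}  f = 0
∑ {suc n} f = f zero + ∑ (λ i → f (suc i))

ind : Bool → ℕ
ind true  = 1
ind false = 0

-- Tactical configuration (X, 𝓑) with parameters (v̄, b̄, k̄, r̄), where the
-- point set X is a subset of an ambient finite set Fin N and the collection
-- 𝓑 of b̄ blocks is an indexed family Fin b̄ → Subset N (repetitions allowed).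

record TacticalConfiguration {N : ℕ} (X : Subset N) (v b k r : ℕ) : Set where
  field
    blocks       : Fin b → Subset N
    pointCount   : ∣ X ∣ ≡ v
    blockInX     : ∀ B → blocks B ⊆ X
    blockSize    : ∀ B → ∣ blocks B ∣ ≡ k
    replication  : ∀ x → x ∈ X → ∣ tabulate (λ B → lookup (blocks B) x) ∣ ≡ r

-- Matrix entries:
--   I x y = δ x y,  J x y = 1,  A x y = ind (A x y),
--   (A²) x y = ∑_z A x z * A z y.

δ : ∀ {v} → Fin v → Fin v → ℕ
δ x y = ind ⌊ x ≟ y ⌋

record IsDSRG (v k t lam mu : ℕ) (A : Fin v → Fin v → Bool) : Set where
  field
    loopless : ∀ x → A x x ≡ false
    AJ : ∀ x → ∑ (λ z → ind (A x z)) ≡ k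
    JA : ∀ y → ∑ (λ z → ind (A z y)) ≡ k
    -- A² = t I + λ A + μ (J − I − A), entrywise
    A² : ∀ x y → ∑ (λ z → ind (A x z) * ind (A z y))
                 ≡ t * δ x y + lam * ind (A x y) + mu * (1 ∸ δ x y ∸ ind (A x y))

DSRG : (v k t lam mu : ℕ) → Set
DSRG v k t lam mu = Σ (Fin v → Fin v → Bool) (IsDSRG v k t lam mu)

module Submission where

-- Vertices are the triples (c, i, B) with c < m a copy index, i < n a
-- configuration and B < s a block of configuration i; write group(c,i,B) = i.
-- The first graph has an arc x → y iff group y lies in block(x) of
-- configuration group(x).  Block sizes give out-degree m·l·s, the replication
-- number d gives in-degree m·d·(n−1) = m·l·s, and counting 2-paths through the
-- group of the middle vertex gives the matrix identity  A² + m·d·A = m·l·d·J.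
-- The second graph A⁺ adds all arcs inside a group; A⁺ + I is the blow-up of
-- the "closed" blocks B ∪ {i}, and the same count gives
--   (A⁺ + I)² + m·d·(A⁺ + I) = m·((l+1)·d·J + s·(A⁺ + I)).
-- Reading these identities off on the diagonal, on arcs and on non-arcs
-- yields the parameters (t, λ, μ) of the theorem.

open import Defs
open import Data.Nat using (ℕ; zero; suc; _+_; _*_; _∸_; _<_)
open import Data.Nat.Properties
  using (+-*-semiring; +-assoc; +-cancelʳ-≡; +-identityʳ; *-identityˡ; *-identityʳ; *-zeroʳ;
         *-comm; *-assoc; *-distribˡ-+; m+n∸n≡m; m∸n+n≡m)
open import Data.Nat.Tactic.RingSolver using (solve-∀)
open import Data.Bool using (Bool; true; false; if_then_else_; _∨_)
open import Data.Fin using (Fin; zero; suc; _↑ˡ_; _↑ʳ_; combine; remQuot; _≟_)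
open import Data.Fin.Properties using (remQuot-combine)
open import Data.Fin.Subset using (Subset; ∣_∣; ⁅_⁆; ∁)
open import Data.Fin.Subset.Properties using (x∈∁p⇒x∉p; x∉p⇒x∈∁p; x∈⁅x⁆; x≢y⇒x∉⁅y⁆)
open import Data.Vec using ([]; _∷_; lookup; tabulate)
open import Data.Vec.Properties using (lookup⇒[]=; lookup∘tabulate)
open import Data.Product using (_×_; _,_; proj₁; proj₂)
open import Data.Empty using (⊥-elim)
open import Relation.Binary.PropositionalEquality
  using (_≡_; _≢_; refl; sym; trans; cong; cong₂; subst; module ≡-Reasoning)
open import Relation.Nullary using (Dec; yes; no; ¬_)
open import Relation.Nullary.Decidable using (⌊_⌋; isYes≗does; dec-true; dec-false)
import Algebra.Properties.Semiring.Sum +-*-semiring as Sum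

open ≡-Reasoning

∑-cong : ∀ {n} {f g : Fin n → ℕ} → (∀ i → f i ≡ g i) → ∑ f ≡ ∑ g
∑-cong {zero}  e = refl
∑-cong {suc n} e = cong₂ _+_ (e zero) (∑-cong (λ i → e (suc i)))

-- ∑ is the library's summation over the semiring ℕ, whose laws we reuse.
∑≡sum : ∀ {n} (f : Fin n → ℕ) → ∑ f ≡ Sum.sum f
∑≡sum {zero}  f = refl
∑≡sum {suc n} f = cong (f zero +_) (∑≡sum (λ i → f (suc i)))

∑-+ : ∀ {n} (f g : Fin n → ℕ) → ∑ (λ i → f i + g i) ≡ ∑ f + ∑ g
∑-+ f g = begin
  ∑ (λ i → f i + g i)        ≡⟨ ∑≡sum (λ i → f i + g i) ⟩
  Sum.sum (λ i → f i + g i)  ≡⟨ Sum.∑-distrib-+ f g ⟩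
  Sum.sum f + Sum.sum g      ≡⟨ sym (cong₂ _+_ (∑≡sum f) (∑≡sum g)) ⟩
  ∑ f + ∑ g                  ∎

∑-* : ∀ {n} (c : ℕ) (f : Fin n → ℕ) → ∑ (λ i → c * f i) ≡ c * ∑ f
∑-* c f = begin
  ∑ (λ i → c * f i)        ≡⟨ ∑≡sum (λ i → c * f i) ⟩
  Sum.sum (λ i → c * f i)  ≡⟨ sym (Sum.*-distribˡ-sum c f) ⟩
  c * Sum.sum f            ≡⟨ cong (c *_) (sym (∑≡sum f)) ⟩
  c * ∑ f                  ∎

∑-const : ∀ {n} (c : ℕ) → ∑ {n} (λ _ → c) ≡ n * c
∑-const {zero}  c = refl
∑-const {suc n} c = cong (c +_) (∑-const {n} c)

∑-ind : ∀ {n} (p : Subset n) → ∑ (λ k → ind (lookup p k)) ≡ ∣ p ∣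
∑-ind []          = refl
∑-ind (true ∷ p)  = cong suc (∑-ind p)
∑-ind (false ∷ p) = ∑-ind p

∑-↑ : ∀ a {b} (f : Fin (a + b) → ℕ) →
      ∑ f ≡ ∑ (λ i → f (i ↑ˡ b)) + ∑ (λ j → f (a ↑ʳ j))
∑-↑ zero    f = refl
∑-↑ (suc a) f = trans (cong (f zero +_) (∑-↑ a (λ i → f (suc i)))) (sym (+-assoc (f zero) _ _))

∑-combine : ∀ a {b} (f : Fin (a * b) → ℕ) →
            ∑ f ≡ ∑ {a} (λ i → ∑ {b} (λ j → f (combine i j)))
∑-combine zero        f = refl
∑-combine (suc a) {b} f =
  trans (∑-↑ b f) (cong (∑ (λ j → f (j ↑ˡ (a * b))) +_) (∑-combine a (λ k → f (b ↑ʳ k))))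

⌊⌋-true : ∀ {A : Set} (a? : Dec A) → A → ⌊ a? ⌋ ≡ true
⌊⌋-true a? a = trans (isYes≗does a?) (dec-true a? a)

⌊⌋-false : ∀ {A : Set} (a? : Dec A) → ¬ A → ⌊ a? ⌋ ≡ false
⌊⌋-false a? ¬a = trans (isYes≗does a?) (dec-false a? ¬a)

δ-refl : ∀ {n} (x : Fin n) → δ x x ≡ 1
δ-refl x = cong ind (⌊⌋-true (x ≟ x) refl)

δ-≢ : ∀ {n} {x y : Fin n} → x ≢ y → δ x y ≡ 0
δ-≢ {x = x} {y} x≢y = cong ind (⌊⌋-false (x ≟ y) x≢y)

equal-or-distinct : ∀ {n} (P : Fin n → Fin n → Set) →
  (∀ x → P x x) → (∀ {x y} → x ≢ y → P x y) → ∀ x y → P x y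
equal-or-distinct P equal distinct x y with x ≟ y
... | yes refl = equal x
... | no x≢y   = distinct x≢y

δ-sym : ∀ {n} (x y : Fin n) → δ x y ≡ δ y x
δ-sym = equal-or-distinct (λ x y → δ x y ≡ δ y x) (λ _ → refl)
  (λ x≢y → trans (δ-≢ x≢y) (sym (δ-≢ (λ y≡x → x≢y (sym y≡x)))))

δ-suc : ∀ {n} (x y : Fin n) → δ (suc x) (suc y) ≡ δ x y
δ-suc x y with x ≟ y
... | yes _ = refl
... | no _  = refl

∑-δˡ : ∀ {n} (x : Fin n) (g : Fin n → ℕ) → ∑ (λ z → δ x z * g z) ≡ g x
∑-δˡ {suc n} zero g =
  trans (cong₂ _+_ (+-identityʳ (g zero)) (trans (∑-const {n} 0) (*-zeroʳ n))) (+-identityʳ (g zero))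
∑-δˡ {suc n} (suc x) g =
  trans (∑-cong (λ i → cong (_* g (suc i)) (δ-suc x i))) (∑-δˡ x (λ i → g (suc i)))

∑-δʳ : ∀ {n} (y : Fin n) (g : Fin n → ℕ) → ∑ (λ z → g z * δ z y) ≡ g y
∑-δʳ y g = trans (∑-cong (λ z → trans (*-comm (g z) (δ z y)) (cong (_* g z) (δ-sym z y)))) (∑-δˡ y g)

∑-δ-row : ∀ {n} (x : Fin n) → ∑ (λ z → δ x z) ≡ 1
∑-δ-row x = trans (∑-cong (λ z → sym (*-identityʳ (δ x z)))) (∑-δˡ x (λ _ → 1))

∑-δ-col : ∀ {n} (y : Fin n) → ∑ (λ z → δ z y) ≡ 1
∑-δ-col y = trans (∑-cong (λ z → δ-sym z y)) (∑-δ-row y)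

∑-scaled-δ : ∀ {n} (c : ℕ) (w : Fin n → ℕ) (j : Fin n) → ∑ (λ k → w k * (c * δ k j)) ≡ c * w j
∑-scaled-δ c w j = trans (∑-cong (λ k → reassoc (w k) c (δ k j))) (∑-δʳ j (λ k → c * w k))
  where
  reassoc : ∀ a c e → a * (c * e) ≡ c * a * e
  reassoc = solve-∀

paths : ∀ {v} → (Fin v → Fin v → Bool) → Fin v → Fin v → ℕ
paths A x y = ∑ (λ z → ind (A x z) * ind (A z y))

square-shift : ∀ {v} (M : Fin v → Fin v → ℕ) (x y : Fin v) →
  ∑ (λ z → (M x z + δ x z) * (M z y + δ z y)) ≡ ∑ (λ z → M x z * M z y) + M x y + M x y + δ x y
square-shift M x y = begin
  ∑ (λ z → (M x z + δ x z) * (M z y + δ z y))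
    ≡⟨ ∑-cong (λ z → expand (M x z) (δ x z) (M z y) (δ z y)) ⟩
  ∑ (λ z → (M x z * M z y + M x z * δ z y) + (δ x z * M z y + δ x z * δ z y))
    ≡⟨ trans (∑-+ (λ z → M x z * M z y + M x z * δ z y) (λ z → δ x z * M z y + δ x z * δ z y))
           (cong₂ _+_ (∑-+ (λ z → M x z * M z y) (λ z → M x z * δ z y))
                      (∑-+ (λ z → δ x z * M z y) (λ z → δ x z * δ z y))) ⟩
  (M² + ∑ (λ z → M x z * δ z y)) + (∑ (λ z → δ x z * M z y) + ∑ (λ z → δ x z * δ z y))
    ≡⟨ cong₂ _+_ (cong (M² +_) (∑-δʳ y (M x)))
                 (cong₂ _+_ (∑-δˡ x (λ z → M z y)) (∑-δˡ x (λ z → δ z y))) ⟩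
  (M² + M x y) + (M x y + δ x y)
    ≡⟨ reassoc M² (M x y) (δ x y) ⟩
  M² + M x y + M x y + δ x y ∎
  where
  M² : ℕ
  M² = ∑ (λ z → M x z * M z y)
  expand : ∀ a b c e → (a + b) * (c + e) ≡ (a * c + a * e) + (b * c + b * e)
  expand = solve-∀
  reassoc : ∀ a b e → (a + b) + (b + e) ≡ a + b + b + e
  reassoc = solve-∀

dsrg-criterion : ∀ {v k t lam mu} (A : Fin v → Fin v → Bool) →
  (∀ x → A x x ≡ false) →
  (∀ x → ∑ (λ z → ind (A x z)) ≡ k) →
  (∀ y → ∑ (λ z → ind (A z y)) ≡ k) →
  (∀ x → paths A x x ≡ t) →
  (∀ x y → x ≢ y → A x y ≡ true → paths A x y ≡ lam) →
  (∀ x y → x ≢ y → A x y ≡ false → paths A x y ≡ mu) →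
  IsDSRG v k t lam mu A
dsrg-criterion {t = t} {lam} {mu} A loopless outdeg indeg diagonal on-arc off-arc =
  record { loopless = loopless ; AJ = outdeg ; JA = indeg ; A² = square }
  where
  only-t : ∀ t lam mu → t ≡ t * 1 + lam * 0 + mu * 0
  only-t = solve-∀
  only-lam : ∀ t lam mu → lam ≡ t * 0 + lam * 1 + mu * 0
  only-lam = solve-∀
  only-mu : ∀ t lam mu → mu ≡ t * 0 + lam * 0 + mu * 1
  only-mu = solve-∀

  square : ∀ x y → paths A x y ≡ t * δ x y + lam * ind (A x y) + mu * (1 ∸ δ x y ∸ ind (A x y))
  square x y with x ≟ y
  ... | yes refl rewrite loopless x = trans (diagonal x) (only-t t lam mu)
  ... | no x≢y with A x y in eq
  ...   | true  = trans (on-arc x y x≢y eq) (only-lam t lam mu)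
  ...   | false = trans (off-arc x y x≢y eq) (only-mu t lam mu)

+⇒∸ : ∀ {a} b {c} → a + b ≡ c → a ≡ c ∸ b
+⇒∸ {a} b h = trans (sym (m+n∸n≡m a b)) (cong (_∸ b) h)

ind-∨-disjoint : ∀ {a b} → (b ≡ true → a ≡ false) → ind (a ∨ b) ≡ ind a + ind b
ind-∨-disjoint {true}  {true}  disjoint with disjoint refl
... | ()
ind-∨-disjoint {true}  {false} disjoint = refl
ind-∨-disjoint {false} {b}     disjoint = refl

-- Fin (m * n * s) encodes the triples (c, i, B); group and block project.
module BlowUp (m n s : ℕ) where

  group : Fin (m * n * s) → Fin n
  group z = proj₂ (remQuot {m} n (proj₁ (remQuot {m * n} s z)))

  block : Fin (m * n * s) → Fin s
  block z = proj₂ (remQuot {m * n} s z)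

  ∑-blowup : (H : Fin n → Fin s → ℕ) →
             ∑ (λ z → H (group z) (block z)) ≡ m * ∑ (λ k → ∑ (H k))
  ∑-blowup H = begin
    ∑ (λ z → H (group z) (block z))
      ≡⟨ ∑-combine (m * n) (λ z → H (group z) (block z)) ⟩
    ∑ {m * n} (λ p → ∑ {s} (λ D → H (group (combine p D)) (block (combine p D))))
      ≡⟨ ∑-cong (λ p → ∑-cong (λ D →
           cong (λ r → H (proj₂ (remQuot {m} n (proj₁ r))) (proj₂ r)) (remQuot-combine p D))) ⟩
    ∑ {m * n} (λ p → ∑ (H (proj₂ (remQuot {m} n p))))
      ≡⟨ ∑-combine m (λ p → ∑ (H (proj₂ (remQuot {m} n p)))) ⟩
    ∑ {m} (λ c → ∑ (λ k → ∑ (H (proj₂ (remQuot {m} n (combine c k))))))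
      ≡⟨ ∑-cong {m} (λ c → ∑-cong {n} (λ k → cong (λ r → ∑ (H (proj₂ r))) (remQuot-combine c k))) ⟩
    ∑ {m} (λ _ → ∑ (λ k → ∑ (H k)))
      ≡⟨ ∑-const {m} (∑ (λ k → ∑ (H k))) ⟩
    m * ∑ (λ k → ∑ (H k)) ∎

  ∑-over-groups : (a : Fin n → ℕ) → ∑ (λ z → a (group z)) ≡ m * (s * ∑ a)
  ∑-over-groups a =
    trans (∑-blowup (λ k _ → a k)) (cong (m *_) (trans (∑-cong (λ k → ∑-const {s} (a k))) (∑-* s a)))

  -- The shape of a 2-path count x → z → y: a(group z) · b(group z, block z).
  ∑-blowup-product : (a : Fin n → ℕ) (b : Fin n → Fin s → ℕ) →
    ∑ (λ z → a (group z) * b (group z) (block z)) ≡ m * ∑ (λ k → a k * ∑ (b k))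
  ∑-blowup-product a b =
    trans (∑-blowup (λ k D → a k * b k D)) (cong (m *_) (∑-cong (λ k → ∑-* (a k) (b k))))

module Configurations (n d l s : ℕ)
  (T : (i : Fin n) → TacticalConfiguration (∁ ⁅ i ⁆) (n ∸ 1) s l d) where
  open TacticalConfiguration

  incident : Fin n → Fin s → Fin n → Bool
  incident i B k = lookup (blocks (T i) B) k

  not-in-own-block : ∀ i B → incident i B i ≡ false
  not-in-own-block i B with lookup (blocks (T i) B) i in eq
  ... | true  = ⊥-elim (x∈∁p⇒x∉p (blockInX (T i) B (lookup⇒[]= i (blocks (T i) B) eq)) (x∈⁅x⁆ i))
  ... | false = refl

  block-size : ∀ i B → ∑ (λ k → ind (incident i B k)) ≡ l
  block-size i B = trans (∑-ind (blocks (T i) B)) (blockSize (T i) B)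

  occ : Fin n → Fin n → ℕ
  occ k j = ∑ (λ D → ind (incident k D j))

  -- occ k j = d·(1 − δₖⱼ): j ≠ k lies in d blocks, k in none.
  occ-count : ∀ k j → occ k j + d * δ k j ≡ d
  occ-count k j with k ≟ j
  ... | yes refl = cong₂ _+_ (trans (∑-cong (λ D → cong ind (not-in-own-block k D)))
                                    (trans (∑-const {s} 0) (*-zeroʳ s)))
                             (*-identityʳ d)
  ... | no k≢j = trans (cong₂ _+_ replicated (*-zeroʳ d)) (+-identityʳ d)
    where
    replicated : occ k j ≡ d
    replicated = begin
      occ k j
        ≡⟨ ∑-cong (λ D → cong ind (sym (lookup∘tabulate (λ B → incident k B j) D))) ⟩
      ∑ (λ D → ind (lookup (tabulate (λ B → incident k B j)) D))
        ≡⟨ ∑-ind (tabulate (λ B → incident k B j)) ⟩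
      ∣ tabulate (λ B → incident k B j) ∣
        ≡⟨ replication (T k) j (x∉p⇒x∈∁p (x≢y⇒x∉⁅y⁆ (λ j≡k → k≢j (sym j≡k)))) ⟩
      d ∎

  weighted-occ : (w : Fin n → ℕ) (j : Fin n) → ∑ (λ k → w k * occ k j) + d * w j ≡ d * ∑ w
  weighted-occ w j = begin
    ∑ (λ k → w k * occ k j) + d * w j
      ≡⟨ cong (∑ (λ k → w k * occ k j) +_) (sym (∑-scaled-δ d w j)) ⟩
    ∑ (λ k → w k * occ k j) + ∑ (λ k → w k * (d * δ k j))
      ≡⟨ sym (∑-+ (λ k → w k * occ k j) (λ k → w k * (d * δ k j))) ⟩
    ∑ (λ k → w k * occ k j + w k * (d * δ k j))
      ≡⟨ ∑-cong (λ k → trans (sym (*-distribˡ-+ (w k) _ _)) (cong (w k *_) (occ-count k j))) ⟩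
    ∑ (λ k → w k * d)
      ≡⟨ trans (∑-cong (λ k → *-comm (w k) d)) (∑-* d w) ⟩
    d * ∑ w ∎

  column-total : 0 < n → d * (n ∸ 1) ≡ l * s → ∀ j → ∑ (λ k → occ k j) ≡ l * s
  column-total 0<n counting j = trans (+-cancelʳ-≡ (d * 1) _ _ total) counting
    where
    total : ∑ (λ k → occ k j) + d * 1 ≡ d * (n ∸ 1) + d * 1
    total = begin
      ∑ (λ k → occ k j) + d * 1
        ≡⟨ cong (_+ d * 1) (∑-cong (λ k → sym (*-identityˡ (occ k j)))) ⟩
      ∑ (λ k → 1 * occ k j) + d * 1
        ≡⟨ weighted-occ (λ _ → 1) j ⟩
      d * ∑ {n} (λ _ → 1)
        ≡⟨ cong (d *_) (trans (∑-const {n} 1) (trans (*-identityʳ n) (sym (m∸n+n≡m 0<n)))) ⟩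
      d * (n ∸ 1 + 1)
        ≡⟨ *-distribˡ-+ d (n ∸ 1) 1 ⟩
      d * (n ∸ 1) + d * 1 ∎

  closed : Fin n → Fin s → Fin n → ℕ
  closed i B k = ind (incident i B k) + δ i k

  closed-size : ∀ i B → ∑ (closed i B) ≡ l + 1
  closed-size i B = trans (∑-+ (λ k → ind (incident i B k)) (δ i)) (cong₂ _+_ (block-size i B) (∑-δ-row i))

  closed-occ : ∀ k j → ∑ (λ D → closed k D j) ≡ occ k j + s * δ k j
  closed-occ k j = trans (∑-+ (λ D → ind (incident k D j)) (λ _ → δ k j)) (cong (occ k j +_) (∑-const {s} (δ k j)))

  weighted-closed : (w : Fin n → ℕ) (j : Fin n) →
    ∑ (λ k → w k * ∑ (λ D → closed k D j)) + d * w j ≡ d * ∑ w + s * w j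
  weighted-closed w j = begin
    ∑ (λ k → w k * ∑ (λ D → closed k D j)) + d * w j
      ≡⟨ cong (_+ d * w j) (∑-cong (λ k →
           trans (cong (w k *_) (closed-occ k j)) (*-distribˡ-+ (w k) _ _))) ⟩
    ∑ (λ k → w k * occ k j + w k * (s * δ k j)) + d * w j
      ≡⟨ cong (_+ d * w j) (trans (∑-+ (λ k → w k * occ k j) (λ k → w k * (s * δ k j))) (cong (∑ (λ k → w k * occ k j) +_) (∑-scaled-δ s w j))) ⟩
    ∑ (λ k → w k * occ k j) + s * w j + d * w j
      ≡⟨ swap (∑ (λ k → w k * occ k j)) (s * w j) (d * w j) ⟩
    ∑ (λ k → w k * occ k j) + d * w j + s * w j
      ≡⟨ cong (_+ s * w j) (weighted-occ w j) ⟩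
    d * ∑ w + s * w j ∎
    where
    swap : ∀ a b c → a + b + c ≡ a + c + b
    swap = solve-∀

module Graphs (n d l s m : ℕ) (0<n : 0 < n) (0<l : 0 < l) (counting : d * (n ∸ 1) ≡ l * s)
  (T : (i : Fin n) → TacticalConfiguration (∁ ⁅ i ⁆) (n ∸ 1) s l d) where
  open BlowUp m n s
  open Configurations n d l s T

  V : ℕ
  V = m * n * s

  arc : Fin V → Fin V → Bool
  arc x y = incident (group x) (block x) (group y)

  arc-loopless : ∀ x → arc x x ≡ false
  arc-loopless x = not-in-own-block (group x) (block x)

  arc-out : ∀ x → ∑ (λ z → ind (arc x z)) ≡ m * l * s
  arc-out x = begin
    ∑ (λ z → ind (arc x z))  ≡⟨ ∑-over-groups (λ k → ind (incident (group x) (block x) k)) ⟩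
    m * (s * ∑ (λ k → ind (incident (group x) (block x) k)))
                             ≡⟨ cong (λ t → m * (s * t)) (block-size (group x) (block x)) ⟩
    m * (s * l)              ≡⟨ reorder m s l ⟩
    m * l * s                ∎
    where
    reorder : ∀ m s l → m * (s * l) ≡ m * l * s
    reorder = solve-∀

  arc-in : ∀ y → ∑ (λ z → ind (arc z y)) ≡ m * l * s
  arc-in y = trans (∑-blowup (λ k D → ind (incident k D (group y))))
                   (trans (cong (m *_) (column-total 0<n counting (group y))) (sym (*-assoc m l s)))

  arc-paths : ∀ x y → paths arc x y + m * d * ind (arc x y) ≡ m * l * d
  arc-paths x y = begin
    paths arc x y + m * d * a
      ≡⟨ cong (_+ m * d * a) (∑-blowup-product (incident′ i B) (λ k D → ind (incident k D j))) ⟩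
    m * ∑ (λ k → incident′ i B k * occ k j) + m * d * a
      ≡⟨ factor m (∑ (λ k → incident′ i B k * occ k j)) d a ⟩
    m * (∑ (λ k → incident′ i B k * occ k j) + d * a)
      ≡⟨ cong (m *_) (weighted-occ (incident′ i B) j) ⟩
    m * (d * ∑ (incident′ i B))
      ≡⟨ cong (λ t → m * (d * t)) (block-size i B) ⟩
    m * (d * l)
      ≡⟨ reorder m d l ⟩
    m * l * d ∎
    where
    i = group x
    B = block x
    j = group y
    a = ind (arc x y)
    incident′ : Fin n → Fin s → Fin n → ℕ
    incident′ i B k = ind (incident i B k)
    factor : ∀ m q d a → m * q + m * d * a ≡ m * (q + d * a)
    factor = solve-∀
    reorder : ∀ m d l → m * (d * l) ≡ m * l * d
    reorder = solve-∀

  arc-paths-without-arc : ∀ {S a} → a ≡ 0 → S + m * d * a ≡ m * l * d → S ≡ m * l * d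
  arc-paths-without-arc {S} refl h = trans (sym (+-identityʳ S)) (trans (cong (S +_) (sym (*-zeroʳ (m * d)))) h)

  arc-paths-along-arc : ∀ {S a} → a ≡ 1 → S + m * d * a ≡ m * l * d → S ≡ m * (l ∸ 1) * d
  arc-paths-along-arc {S} refl h = +-cancelʳ-≡ (m * d * 1) _ _ (trans h split)
    where
    split : m * l * d ≡ m * (l ∸ 1) * d + m * d * 1
    split = trans (cong (λ t → m * t * d) (sym (m∸n+n≡m 0<l))) (distrib m (l ∸ 1) d)
      where
      distrib : ∀ m l′ d → m * (l′ + 1) * d ≡ m * l′ * d + m * d * 1
      distrib = solve-∀

  first-graph : IsDSRG V (m * l * s) (m * l * d) (m * (l ∸ 1) * d) (m * l * d) arc
  first-graph = dsrg-criterion arc arc-loopless arc-out arc-in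
    (λ x → arc-paths-without-arc (cong ind (arc-loopless x)) (arc-paths x x))
    (λ x y _ on → arc-paths-along-arc (cong ind on) (arc-paths x y))
    (λ x y _ off → arc-paths-without-arc (cong ind off) (arc-paths x y))

  same-group : Fin V → Fin V → Bool
  same-group x y = ⌊ group x ≟ group y ⌋

  arc⁺ : Fin V → Fin V → Bool
  arc⁺ x y = if ⌊ x ≟ y ⌋ then false else (arc x y ∨ same-group x y)

  arc⁺-loopless : ∀ x → arc⁺ x x ≡ false
  arc⁺-loopless x = cong (λ b → if b then false else (arc x x ∨ same-group x x)) (⌊⌋-true (x ≟ x) refl)

  arc⁺-off-diagonal : ∀ {x y} → x ≢ y → arc⁺ x y ≡ (arc x y ∨ same-group x y)
  arc⁺-off-diagonal {x} {y} x≢y =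
    cong (λ b → if b then false else (arc x y ∨ same-group x y)) (⌊⌋-false (x ≟ y) x≢y)

  no-arc-in-group : ∀ x y → same-group x y ≡ true → arc x y ≡ false
  no-arc-in-group x y same with group x ≟ group y
  ... | yes g≡g = subst (λ k → incident (group x) (block x) k ≡ false) g≡g (arc-loopless x)
  no-arc-in-group x y () | no _

  closed-shift : ∀ x y → ind (arc⁺ x y) + δ x y ≡ closed (group x) (block x) (group y)
  closed-shift = equal-or-distinct (λ x y → ind (arc⁺ x y) + δ x y ≡ closed (group x) (block x) (group y))
                                   on-diagonal off-diagonal
    where
    on-diagonal : ∀ x → ind (arc⁺ x x) + δ x x ≡ closed (group x) (block x) (group x)
    on-diagonal x = begin
      ind (arc⁺ x x) + δ x x                 ≡⟨ cong₂ _+_ (cong ind (arc⁺-loopless x)) (δ-refl x) ⟩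
      0 + 1                                  ≡⟨ sym (cong₂ _+_ (cong ind (arc-loopless x)) (δ-refl (group x))) ⟩
      ind (arc x x) + δ (group x) (group x)  ∎
    off-diagonal : ∀ {x y} → x ≢ y → ind (arc⁺ x y) + δ x y ≡ closed (group x) (block x) (group y)
    off-diagonal {x} {y} x≢y = begin
      ind (arc⁺ x y) + δ x y                 ≡⟨ cong₂ _+_ (cong ind (arc⁺-off-diagonal x≢y)) (δ-≢ x≢y) ⟩
      ind (arc x y ∨ same-group x y) + 0     ≡⟨ +-identityʳ _ ⟩
      ind (arc x y ∨ same-group x y)         ≡⟨ ind-∨-disjoint (no-arc-in-group x y) ⟩
      ind (arc x y) + δ (group x) (group y)  ∎

  arc⁺-out : ∀ x → ∑ (λ z → ind (arc⁺ x z)) ≡ m * (l * s + s) ∸ 1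
  arc⁺-out x = +⇒∸ 1 (begin
    ∑ (λ z → ind (arc⁺ x z)) + 1
      ≡⟨ cong (∑ (λ z → ind (arc⁺ x z)) +_) (sym (∑-δ-row x)) ⟩
    ∑ (λ z → ind (arc⁺ x z)) + ∑ (λ z → δ x z)
      ≡⟨ sym (∑-+ (λ z → ind (arc⁺ x z)) (δ x)) ⟩
    ∑ (λ z → ind (arc⁺ x z) + δ x z)
      ≡⟨ ∑-cong (closed-shift x) ⟩
    ∑ (λ z → closed (group x) (block x) (group z))
      ≡⟨ ∑-over-groups (closed (group x) (block x)) ⟩
    m * (s * ∑ (closed (group x) (block x)))
      ≡⟨ cong (λ t → m * (s * t)) (closed-size (group x) (block x)) ⟩
    m * (s * (l + 1))
      ≡⟨ reorder m s l ⟩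
    m * (l * s + s) ∎)
    where
    reorder : ∀ m s l → m * (s * (l + 1)) ≡ m * (l * s + s)
    reorder = solve-∀

  arc⁺-in : ∀ y → ∑ (λ z → ind (arc⁺ z y)) ≡ m * (l * s + s) ∸ 1
  arc⁺-in y = +⇒∸ 1 (begin
    ∑ (λ z → ind (arc⁺ z y)) + 1
      ≡⟨ cong (∑ (λ z → ind (arc⁺ z y)) +_) (sym (∑-δ-col y)) ⟩
    ∑ (λ z → ind (arc⁺ z y)) + ∑ (λ z → δ z y)
      ≡⟨ sym (∑-+ (λ z → ind (arc⁺ z y)) (λ z → δ z y)) ⟩
    ∑ (λ z → ind (arc⁺ z y) + δ z y)
      ≡⟨ ∑-cong (λ z → closed-shift z y) ⟩
    ∑ (λ z → closed (group z) (block z) j)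
      ≡⟨ ∑-blowup (λ k D → closed k D j) ⟩
    m * ∑ (λ k → ∑ (λ D → closed k D j))
      ≡⟨ cong (m *_) (trans (∑-cong (λ k → closed-occ k j)) (∑-+ (λ k → occ k j) (λ k → s * δ k j))) ⟩
    m * (∑ (λ k → occ k j) + ∑ (λ k → s * δ k j))
      ≡⟨ cong (m *_) (cong₂ _+_ (column-total 0<n counting j)
                                (trans (∑-* s (λ k → δ k j)) (cong (s *_) (∑-δ-col j)))) ⟩
    m * (l * s + s * 1)
      ≡⟨ cong (λ t → m * (l * s + t)) (*-identityʳ s) ⟩
    m * (l * s + s) ∎)
    where
    j = group y

  arc⁺-paths : ∀ x y →
    paths arc⁺ x y + ind (arc⁺ x y) + ind (arc⁺ x y) + δ x y + m * d * (ind (arc⁺ x y) + δ x y)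
      ≡ m * (d * (l + 1) + s * (ind (arc⁺ x y) + δ x y))
  arc⁺-paths x y = begin
    paths arc⁺ x y + ind (arc⁺ x y) + ind (arc⁺ x y) + δ x y + m * d * (ind (arc⁺ x y) + δ x y)
      ≡⟨ cong₂ _+_ (sym (square-shift (λ u v → ind (arc⁺ u v)) x y)) (cong (m * d *_) (closed-shift x y)) ⟩
    ∑ (λ z → (ind (arc⁺ x z) + δ x z) * (ind (arc⁺ z y) + δ z y)) + m * d * closed i B j
      ≡⟨ cong (_+ m * d * closed i B j)
           (∑-cong (λ z → cong₂ _*_ (closed-shift x z) (closed-shift z y))) ⟩
    ∑ (λ z → closed i B (group z) * closed (group z) (block z) j) + m * d * closed i B j
      ≡⟨ cong (_+ m * d * closed i B j) (∑-blowup-product (closed i B) (λ k D → closed k D j)) ⟩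
    m * Q + m * d * closed i B j
      ≡⟨ factor m Q d (closed i B j) ⟩
    m * (Q + d * closed i B j)
      ≡⟨ cong (m *_) (weighted-closed (closed i B) j) ⟩
    m * (d * ∑ (closed i B) + s * closed i B j)
      ≡⟨ cong₂ (λ t u → m * (d * t + s * u)) (closed-size i B) (sym (closed-shift x y)) ⟩
    m * (d * (l + 1) + s * (ind (arc⁺ x y) + δ x y)) ∎
    where
    i = group x
    B = block x
    j = group y
    Q : ℕ
    Q = ∑ (λ k → closed i B k * ∑ (λ D → closed k D j))
    factor : ∀ m q d a → m * q + m * d * a ≡ m * (q + d * a)
    factor = solve-∀

  arc⁺-paths-diagonal : ∀ {S a e} → a ≡ 0 → e ≡ 1 →
    S + a + a + e + m * d * (a + e) ≡ m * (d * (l + 1) + s * (a + e)) → S ≡ m * (l * d + s) ∸ 1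
  arc⁺-paths-diagonal {S} refl refl h = +⇒∸ 1 (+-cancelʳ-≡ (m * d) _ _ (trans (lhs S m d) (trans h (rhs m d l s))))
    where
    lhs : ∀ S m d → S + 1 + m * d ≡ S + 0 + 0 + 1 + m * d * (0 + 1)
    lhs = solve-∀
    rhs : ∀ m d l s → m * (d * (l + 1) + s * (0 + 1)) ≡ m * (l * d + s) + m * d
    rhs = solve-∀

  arc⁺-paths-along-arc : ∀ {S a e} → a ≡ 1 → e ≡ 0 →
    S + a + a + e + m * d * (a + e) ≡ m * (d * (l + 1) + s * (a + e)) → S ≡ m * (l * d + s) ∸ 2
  arc⁺-paths-along-arc {S} refl refl h = +⇒∸ 2 (+-cancelʳ-≡ (m * d) _ _ (trans (lhs S m d) (trans h (rhs m d l s))))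
    where
    lhs : ∀ S m d → S + 2 + m * d ≡ S + 1 + 1 + 0 + m * d * (1 + 0)
    lhs = solve-∀
    rhs : ∀ m d l s → m * (d * (l + 1) + s * (1 + 0)) ≡ m * (l * d + s) + m * d
    rhs = solve-∀

  arc⁺-paths-without-arc : ∀ {S a e} → a ≡ 0 → e ≡ 0 →
    S + a + a + e + m * d * (a + e) ≡ m * (d * (l + 1) + s * (a + e)) → S ≡ m * (l + 1) * d
  arc⁺-paths-without-arc {S} refl refl h = trans (lhs S m d) (trans h (rhs m d l s))
    where
    lhs : ∀ S m d → S ≡ S + 0 + 0 + 0 + m * d * (0 + 0)
    lhs = solve-∀
    rhs : ∀ m d l s → m * (d * (l + 1) + s * (0 + 0)) ≡ m * (l + 1) * d
    rhs = solve-∀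

  second-graph : IsDSRG V (m * (l * s + s) ∸ 1) (m * (l * d + s) ∸ 1) (m * (l * d + s) ∸ 2)
                          (m * (l + 1) * d) arc⁺
  second-graph = dsrg-criterion arc⁺ arc⁺-loopless arc⁺-out arc⁺-in
    (λ x → arc⁺-paths-diagonal (cong ind (arc⁺-loopless x)) (δ-refl x) (arc⁺-paths x x))
    (λ x y x≢y on → arc⁺-paths-along-arc (cong ind on) (δ-≢ x≢y) (arc⁺-paths x y))
    (λ x y x≢y off → arc⁺-paths-without-arc (cong ind off) (δ-≢ x≢y) (arc⁺-paths x y))

mainTheorem8 : (n d l s : ℕ) → 0 < n → 0 < d → 0 < l → 0 < s →
    d * (n ∸ 1) ≡ l * s →
    ((i : Fin n) → TacticalConfiguration (∁ ⁅ i ⁆) (n ∸ 1) s l d) →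
    (m : ℕ) → 0 < m →
    DSRG (m * n * s) (m * l * s) (m * l * d) (m * (l ∸ 1) * d) (m * l * d)
    × DSRG (m * n * s) (m * (l * s + s) ∸ 1) (m * (l * d + s) ∸ 1)
           (m * (l * d + s) ∸ 2) (m * (l + 1) * d)
mainTheorem8 n d l s 0<n _ 0<l _ counting T m _ = (arc , first-graph) , (arc⁺ , second-graph)
  where open Graphs n d l s m 0<n 0<l counting T
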